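{- The $\omega$-word $\boldsymbol\ell=\lim_{n\to\infty}\ell_n$ is the lexicographically least faux-bonacci $\omega$-word, and $\boldsymbol m=\lim_{n\to\infty}m_n$ is the lexicographically greatest faux-bonacci $\omega$-word.
   Context: For non-empty $X$, $X^-$ is $X$ with last letter erased; a $4^-$-power is $XXXX^-$ with $X$ non-empty; a binary word is faux-bonacci (fb) if it has no factor $11$ and no factor that is a $4^-$-power. Words are ordered lexicographically with $0<1$. For $n\ge0$, $\ell_n$ (resp. $m_n$) is the lexicographically least (resp. greatest) binary word of length $n$ that is a prefix of some fb $\omega$-word; $\ell_n$ is a prefix of $\ell_{n+1}$ and $m_n$ is a prefix of $m_{n+1}$, so the limits are well-defined $\omega$-words. -}

module Defs where

open import Data.Bool using (Bool; true; false)
open import Data.Nat using (ℕ; _+_; _<_)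
open import Data.List using (List; []; _∷_; _++_; length; lookup; applyUpTo)
open import Data.Fin using (Fin; toℕ)
open import Data.Product using (Σ; ∃; _×_)
open import Relation.Nullary using (¬_)
open import Relation.Binary.PropositionalEquality using (_≡_; _≢_)

-- Binary letters: false = 0, true = 1 (so 0 < 1).
Word : Set
Word = List Bool

ωWord : Set
ωWord = ℕ → Bool

-- X⁻ : X with its last letter erased (used only for non-empty X).
dropLast : Word → Word
dropLast []           = []
dropLast (x ∷ [])     = []
dropLast (x ∷ y ∷ xs) = x ∷ dropLast (y ∷ xs)

pow4⁻ : Word → Word
pow4⁻ X = X ++ X ++ X ++ dropLast X

IsFactor : Word → Word → Set
IsFactor f u = Σ Word λ p → Σ Word λ s → u ≡ p ++ f ++ s

FB : Word → Set
FB u = ¬ IsFactor (true ∷ true ∷ []) u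
     × (∀ X → X ≢ [] → ¬ IsFactor (pow4⁻ X) u)

Occurs : Word → ωWord → Set
Occurs f w = ∃ λ i → ∀ (j : Fin (length f)) → w (i + toℕ j) ≡ lookup f j

FBω : ωWord → Set
FBω w = ¬ Occurs (true ∷ true ∷ []) w
      × (∀ X → X ≢ [] → ¬ Occurs (pow4⁻ X) w)

prefix : ℕ → ωWord → Word
prefix n w = applyUpTo w n

ExtendsToFB : Word → Set
ExtendsToFB u = ∃ λ w → FBω w × prefix (length u) w ≡ u

-- strict lexicographic order on finite words (used for words of equal length).
_<ₗ_ : Word → Word → Set
u <ₗ v = Σ Word λ p → Σ Word λ a → Σ Word λ b →
           (u ≡ p ++ false ∷ a) × (v ≡ p ++ true ∷ b)

-- u is ℓ_n : the lexicographically least length-n word that is a prefix of some fb ω-word.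
IsLeastPrefix : ℕ → Word → Set
IsLeastPrefix n u = length u ≡ n × ExtendsToFB u
  × (∀ v → length v ≡ n → ExtendsToFB v → ¬ (v <ₗ u))

-- u is m_n : the lexicographically greatest such word.
IsGreatestPrefix : ℕ → Word → Set
IsGreatestPrefix n u = length u ≡ n × ExtendsToFB u
  × (∀ v → length v ≡ n → ExtendsToFB v → ¬ (u <ₗ v))

_<ω_ : ωWord → ωWord → Set
w <ω v = ∃ λ i → (∀ j → j < i → w j ≡ v j) × w i ≡ false × v i ≡ true

{-# OPTIONS --safe #-}
module Submission where

-- Being faux-bonacci is a closed condition: a forbidden factor of an ω-word lies inside
-- one of its prefixes, so an ω-word all of whose prefixes extend to fb ω-words is itself fb.
-- If an fb ω-word w were lexicographically below L at position i, then the length-(i+1)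
-- prefix of w would be an extendable word below ℓ_{i+1}; symmetrically for M.

open import Defs
open import Data.Bool using (true)
open import Data.Fin using (Fin; toℕ)
open import Data.Fin.Properties using (toℕ<n)
open import Data.List using ([]; _∷_; _∷ʳ_; length; lookup)
open import Data.List.Properties using (length-applyUpTo; applyUpTo-∷ʳ; ∷-injective)
open import Data.Nat using (ℕ; zero; suc; _+_; _<_; s≤s; z≤n)
open import Data.Nat.Properties using (+-monoʳ-<)
open import Data.Product using (∃; _×_; _,_; proj₁; proj₂)
open import Relation.Nullary using (¬_)
open import Relation.Binary.PropositionalEquality
  using (_≡_; refl; sym; trans; cong; cong₂; subst)

AgreeBelow : ℕ → ωWord → ωWord → Set
AgreeBelow n w v = ∀ k → k < n → w k ≡ v k

prefix-≡⇒agreeBelow : ∀ n (w v : ωWord) → prefix n w ≡ prefix n v → AgreeBelow n w v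
prefix-≡⇒agreeBelow (suc n) w v eq zero    _         = proj₁ (∷-injective eq)
prefix-≡⇒agreeBelow (suc n) w v eq (suc k) (s≤s k<n) =
  prefix-≡⇒agreeBelow n (λ x → w (suc x)) (λ x → v (suc x)) (proj₂ (∷-injective eq)) k k<n

agreeBelow⇒prefix-≡ : ∀ n (w v : ωWord) → AgreeBelow n w v → prefix n w ≡ prefix n v
agreeBelow⇒prefix-≡ zero    w v agree = refl
agreeBelow⇒prefix-≡ (suc n) w v agree = cong₂ _∷_ (agree 0 (s≤s z≤n))
  (agreeBelow⇒prefix-≡ n (λ x → w (suc x)) (λ x → v (suc x)) (λ k k<n → agree (suc k) (s≤s k<n)))

occurs-transfer : ∀ f i (w v : ωWord) → prefix (i + length f) w ≡ prefix (i + length f) v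
                → (∀ (j : Fin (length f)) → v (i + toℕ j) ≡ lookup f j) → Occurs f w
occurs-transfer f i w v eq occ = i , λ j →
  trans (prefix-≡⇒agreeBelow (i + length f) w v eq (i + toℕ j) (+-monoʳ-< i (toℕ<n j))) (occ j)

prefix-extendsToFB : ∀ n (w : ωWord) → FBω w → ExtendsToFB (prefix n w)
prefix-extendsToFB n w fb =
  w , fb , subst (λ m → prefix m w ≡ prefix n w) (sym (length-applyUpTo w n)) refl

extendsToFB-prefix : ∀ n (v : ωWord) → ExtendsToFB (prefix n v)
                   → ∃ λ w → FBω w × prefix n w ≡ prefix n v
extendsToFB-prefix n v ext rewrite length-applyUpTo v n = ext

FBω-closed : (v : ωWord) → (∀ n → ExtendsToFB (prefix n v)) → FBω v
FBω-closed v ext = no-11 , no-pow4⁻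
  where
  avoids : ∀ f → (∀ w → FBω w → ¬ Occurs f w) → ¬ Occurs f v
  avoids f absent (i , occ) with extendsToFB-prefix (i + length f) v (ext (i + length f))
  ... | w , fb , eq = absent w fb (occurs-transfer f i w v eq occ)

  no-11 : ¬ Occurs (true ∷ true ∷ []) v
  no-11 = avoids (true ∷ true ∷ []) (λ w fb → proj₁ fb)

  no-pow4⁻ : ∀ X → ¬ X ≡ [] → ¬ Occurs (pow4⁻ X) v
  no-pow4⁻ X X≢[] = avoids (pow4⁻ X) (λ w fb → proj₂ fb X X≢[])

<ω⇒prefix-<ₗ : ∀ (w v : ωWord) → w <ω v → ∃ λ i → prefix (suc i) w <ₗ prefix (suc i) v
<ω⇒prefix-<ₗ w v (i , agree , wi≡0 , vi≡1) =
  i , prefix i w , [] , []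
    , sym (trans (cong (prefix i w ∷ʳ_) (sym wi≡0)) (applyUpTo-∷ʳ w i))
    , sym (trans (cong₂ _∷ʳ_ (agreeBelow⇒prefix-≡ i w v agree) (sym vi≡1)) (applyUpTo-∷ʳ v i))

lemma11 : ((L : ωWord) → (∀ n → IsLeastPrefix n (prefix n L))
    → FBω L × (∀ w → FBω w → ¬ (w <ω L)))
    × ((M : ωWord) → (∀ n → IsGreatestPrefix n (prefix n M))
    → FBω M × (∀ w → FBω w → ¬ (M <ω w)))
lemma11 = least , greatest
  where
  least : (L : ωWord) → (∀ n → IsLeastPrefix n (prefix n L))
        → FBω L × (∀ w → FBω w → ¬ (w <ω L))
  least L isℓ = FBω-closed L (λ n → proj₁ (proj₂ (isℓ n))) , λ w fb w<L →
    let (i , w<ₗL) = <ω⇒prefix-<ₗ w L w<L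
    in proj₂ (proj₂ (isℓ (suc i))) (prefix (suc i) w) (length-applyUpTo w (suc i))
         (prefix-extendsToFB (suc i) w fb) w<ₗL

  greatest : (M : ωWord) → (∀ n → IsGreatestPrefix n (prefix n M))
           → FBω M × (∀ w → FBω w → ¬ (M <ω w))
  greatest M isM = FBω-closed M (λ n → proj₁ (proj₂ (isM n))) , λ w fb M<w →
    let (i , M<ₗw) = <ω⇒prefix-<ₗ M w M<w
    in proj₂ (proj₂ (isM (suc i))) (prefix (suc i) w) (length-applyUpTo w (suc i))
         (prefix-extendsToFB (suc i) w fb) M<ₗw
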